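{- Let $G=Q_n(X)$ be a daisy cube. If $H$ is a $\le$-subgraph of $G$, then $H$ is isomorphic to a daisy cube.
   Context: $B=\{0,1\}$; $Q_n$ has vertex set $B^n$ (binary strings of length $n$), two strings adjacent iff they differ in exactly one position. For $u,v\in B^n$ write $u\le v$ if $u_i\le v_i$ for all $i$. For $X\subseteq B^n$ the daisy cube $Q_n(X)$ is the subgraph of $Q_n$ induced by $\{u: u\le x\text{ for some } x\in X\}$. An induced subgraph $H$ of a daisy cube $G$ is a $\le$-subgraph if $V(H)=\{u\in V(G): u\le v \text{ for some } v\in V(H)\}$. -}

module Defs where

open import Data.Nat using (ℕ)
open import Data.Bool using (Bool) renaming (_≤_ to _≤ᵇ_)
open import Data.Vec using (Vec; lookup)
open import Data.Fin using (Fin)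
open import Data.Product using (Σ; ∃; ∃-syntax; _×_)
open import Relation.Binary.PropositionalEquality using (_≡_; _≢_)
open import Function.Bundles using (_⇔_)

Word : ℕ → Set
Word n = Vec Bool n

Subset : ℕ → Set₁
Subset n = Word n → Set

_≼_ : ∀ {n} → Word n → Word n → Set
u ≼ v = ∀ i → lookup u i ≤ᵇ lookup v i

Adjacent : ∀ {n} → Word n → Word n → Set
Adjacent {n} u v =
  ∃[ i ] (lookup u i ≢ lookup v i × (∀ (j : Fin n) → j ≢ i → lookup u j ≡ lookup v j))

DaisyVertices : ∀ {n} → Subset n → Subset n
DaisyVertices X u = ∃[ x ] (X x × u ≼ x)

IsLeqSubgraph : ∀ {n} → Subset n → Subset n → Set
IsLeqSubgraph {n} X S =
  ∀ (u : Word n) → S u ⇔ (DaisyVertices X u × ∃[ v ] (S v × u ≼ v))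

-- the induced subgraph of Q_n on S is isomorphic to the induced subgraph of Q_m on T:
-- mutually inverse bijections between S and T preserving and reflecting adjacency
InducedIso : ∀ {n m} → Subset n → Subset m → Set
InducedIso {n} {m} S T =
  Σ (Word n → Word m) λ f → Σ (Word m → Word n) λ g →
    (∀ u → S u → T (f u)) ×
    (∀ v → T v → S (g v)) ×
    (∀ u → S u → g (f u) ≡ u) ×
    (∀ v → T v → f (g v) ≡ v) ×
    (∀ u v → S u → S v → Adjacent u v ⇔ Adjacent (f u) (f v))

-- The defining condition of a ≤-subgraph says that V(H) is closed downwards
-- under the coordinatewise order ≼ of B^n.  Every set S of words is contained
-- in the vertex set of Q_n(S) (by reflexivity of ≼), and a downward closed S
-- also contains it (a vertex of Q_n(S) lies below some element of S).  Hence
-- V(H) and V(Q_n(V(H))) are the same subset of B^n; both graphs are induced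
-- subgraphs of Q_n, so the identity map is an isomorphism between them.
module Submission where

open import Defs
open import Data.Nat using (ℕ)
open import Data.Product using (∃-syntax; _,_)
open import Data.Bool.Properties using (≤-refl; ≤-trans)
open import Function.Base using (id)
open import Function.Bundles using (_⇔_; mk⇔; Equivalence)
open import Relation.Binary.PropositionalEquality using (refl)

≼-refl : ∀ {n} (u : Word n) → u ≼ u
≼-refl u i = ≤-refl

≼-trans : ∀ {n} {u v w : Word n} → u ≼ v → v ≼ w → u ≼ w
≼-trans u≼v v≼w i = ≤-trans (u≼v i) (v≼w i)

DownClosed : ∀ {n} → Subset n → Set
DownClosed {n} S = ∀ (u v : Word n) → S v → u ≼ v → S u

-- The vertex set of a ≤-subgraph is downward closed: a word u below some
-- v ∈ V(H) is below the element of X that dominates v, so u ∈ V(G), and the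
-- ≤-subgraph condition then puts u in V(H).
leqSubgraph-downClosed : ∀ {n} (X S : Subset n) → IsLeqSubgraph X S → DownClosed S
leqSubgraph-downClosed X S leq u v Sv u≼v with Equivalence.to (leq v) Sv
... | (x , Xx , v≼x) , _ =
  Equivalence.from (leq u) ((x , Xx , ≼-trans {u = u} {v} {x} u≼v v≼x) , v , Sv , u≼v)

downClosed-daisy : ∀ {n} (S : Subset n) → DownClosed S → ∀ u → S u ⇔ DaisyVertices S u
downClosed-daisy S down u =
  mk⇔ (λ Su → u , Su , ≼-refl u) (λ (v , Sv , u≼v) → down u v Sv u≼v)

sameVertices-iso : ∀ {n} (S T : Subset n) → (∀ u → S u ⇔ T u) → InducedIso S T
sameVertices-iso S T S⇔T =
  id , id ,
  (λ u → Equivalence.to (S⇔T u)) ,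
  (λ v → Equivalence.from (S⇔T v)) ,
  (λ _ _ → refl) , (λ _ _ → refl) ,
  (λ _ _ _ _ → mk⇔ id id)

proposition2p5 : ∀ (n : ℕ) (X : Subset n) (S : Subset n) → IsLeqSubgraph X S →
    ∃[ m ] ∃[ Y ] InducedIso S (DaisyVertices {m} Y)
proposition2p5 n X S leq =
  n , S , sameVertices-iso S (DaisyVertices S)
            (downClosed-daisy S (leqSubgraph-downClosed X S leq))
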